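{- Let $k\ge1$ and $m\ge1$ be integers. Then there exists an integer $b$ such that $\varphi(b,m,k)=\varphi_{min}(m,k)$ and such that for every odd prime $p$ dividing $m-1$, $$F_{b,m}(p)=\left\lceil\frac{m}{p}\right\rceil\ \Longrightarrow\ F_{b,m}(2p)=\left\lceil\frac{m}{2p}\right\rceil.$$
   Context: $p_i$ denotes the $i$-th prime ($p_1=2$) and $P_k=p_1\cdots p_k$. For integers $b$, $m\ge0$, $d\ge1$, $F_{b,m}(d)$ is the number of integers $a$ with $b<a\le b+m$ and $d\mid a$. $\varphi(b,m,k)$ is the number of integers $a$ with $b<a\le b+m$ and $\gcd(a,P_k)=1$, and $\varphi_{min}(m,k)=\min_{b\in\mathbb{Z}}\varphi(b,m,k)$. -}

module Defs where

open import Data.Nat as ℕ using (ℕ; zero; suc; _+_; _*_; _∸_; _≤_; _<_; NonZero; _!)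
open import Data.Nat.Primality using (Prime; prime?)
open import Data.Integer as ℤ using (ℤ; +_)
open import Data.Integer.Divisibility.Signed using (_∣?_) renaming (_∣_ to _∣ℤ_)
open import Data.Integer.DivMod using ()
open import Data.Integer.GCD using () renaming (gcd to gcdℤ)
open import Relation.Nullary using (Dec; yes; no; does)
open import Relation.Binary.PropositionalEquality using (_≡_)
open import Data.Bool using (Bool; true; false; if_then_else_)

count : (m : ℕ) → (P : ℕ → Set) → ((j : ℕ) → Dec (P j)) → ℕ
count zero    P P? = 0
count (suc m) P P? = count m P P? + (if does (P? m) then 1 else 0)

-- smallest prime q with n < q, searched among n+1, n+2, ..., n+fuel
-- (returns n + fuel + 1 if none found, which never happens for fuel = n ! below)
nextPrimeFrom : ℕ → ℕ → ℕ
nextPrimeFrom n zero = suc n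
nextPrimeFrom n (suc fuel) with prime? (suc n)
... | yes _ = suc n
... | no  _ = nextPrimeFrom (suc n) fuel

-- least prime greater than n (Euclid: some prime lies in (n, n!+1])
nextPrime : ℕ → ℕ
nextPrime n = nextPrimeFrom n (n !)

-- p i = i-th prime, p 1 = 2 (p 0 = 1 is an unused convention)
p : ℕ → ℕ
p zero    = 1
p (suc i) = nextPrime (p i)

primorial : ℕ → ℕ
primorial zero    = 1
primorial (suc k) = primorial k * p (suc k)

-- F_{b,m}(d) = #{ a ∈ ℤ : b < a ≤ b + m, d ∣ a },  with a = b + (j+1), j < m
F : ℤ → ℕ → ℕ → ℕ
F b m d = count m (λ j → (+ d) ∣ℤ (b ℤ.+ + suc j))
                  (λ j → (+ d) ∣? (b ℤ.+ + suc j))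

φ : ℤ → ℕ → ℕ → ℕ
φ b m k = count m (λ j → gcdℤ (b ℤ.+ + suc j) (+ primorial k) ≡ + 1)
                  (λ j → gcdℤ (b ℤ.+ + suc j) (+ primorial k) ℤ.≟ + 1)

-- φ(b,m,k) = φ_min(m,k), i.e. b attains the minimum of φ(·,m,k) over ℤ
AttainsMin : ℤ → ℕ → ℕ → Set
AttainsMin b m k = ∀ (b′ : ℤ) → φ b m k ≤ φ b′ m k

-- ⌈ m / d ⌉ for d ≠ 0 (value at d = 0 is an unused convention)
⌈_/_⌉ : ℕ → ℕ → ℕ
⌈ m / zero ⌉  = 0
⌈ m / suc d ⌉ = (m + d) ℕ./ suc d

-- φ(·, m, k) is periodic with period P_k, so it attains its minimum, say at b₀. If m is odd
-- and b₀ is even, the window of b₀ + 1 loses the odd number b₀ + 1 and gains the even number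
-- b₀ + m + 1, which is not coprime to P_k; so b₀ + 1 is a minimiser too, and we may assume
-- that b + 1 is even whenever m is odd.
-- Write m − 1 = t q. The window (b, b + m] contains t + 1 = ⌈m / q⌉ multiples of q exactly
-- when q ∣ b + 1, namely b + 1 + i q for 0 ≤ i ≤ t. If t = 2s then m is odd, so 2q ∣ b + 1 and
-- the window contains s + 1 multiples of 2q. If t = 2s + 1 these multiples of q alternate in
-- parity, so again s + 1 of them are multiples of 2q. In both cases s + 1 = ⌈m / 2q⌉.
module Submission where

open import Defs
open import Data.Nat using (ℕ; _≤_; _∸_; _*_)
open import Data.Nat.Primality using (Prime)
open import Data.Nat.Divisibility using (_∣_)
open import Data.Integer using (ℤ)
open import Data.Product using (∃; _×_)
open import Relation.Nullary using (¬_)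
open import Relation.Binary.PropositionalEquality using (_≡_)

open import Data.Bool using (if_then_else_)
open import Data.Product using (_,_)
open import Data.Integer
  using (+_; -[1+_]; 0ℤ; 1ℤ; -_; _≟_; _%ℕ_; _/ℕ_)
  renaming (_+_ to _+ᶻ_; _*_ to _*ᶻ_)
open import Data.Integer.DivMod using (n%ℕd<d; a≡a%ℕn+[a/ℕn]*n)
import Data.Integer.Divisibility as ℤᵘ
open import Data.Integer.Divisibility.Signed
  using (_∣?_; divides; ∣ᵤ⇒∣; ∣⇒∣ᵤ; ∣m∣n⇒∣m+n; ∣m+n∣m⇒∣n; ∣m+n∣n⇒∣m)
  renaming (_∣_ to _∣ᶻ_; ∣-refl to ∣ᶻ-refl; ∣-trans to ∣ᶻ-trans)
open import Data.Integer.GCD using (gcd[i,j]∣i; gcd[i,j]∣j; gcd-greatest) renaming (gcd to gcdℤ)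
open import Data.Integer.Properties using (pos-+; pos-*) renaming (+-assoc to +ᶻ-assoc)
open import Data.Integer.Tactic.RingSolver using (solve-∀)
open import Data.List using (upTo)
open import Data.List.Extrema.Nat using (argmin; f[argmin]≤f[xs])
open import Data.List.Membership.Propositional.Properties using (∈-upTo⁺)
open import Data.List.Relation.Unary.All using (lookup)
open import Data.Nat
  using (suc; zero; _+_; _<_; _!; >-nonZero⁻¹; s≤s; z≤n; z<s; NonZero; _/_; nonTrivial⇒n>1)
open import Data.Nat.Coprimality using (Coprime; coprime⇒gcd≡1; prime⇒coprime)
  renaming (sym to coprime-sym)
open import Data.Nat.Divisibility
  using (divides; ∣-refl; ∣-trans; ∣-antisym; ∣⇒≤; n∣m*n; m∣m*n)
  renaming (∣m+n∣m⇒∣n to ∣m+n∣m⇒∣nᴺ)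
open import Data.Nat.DivMod using (+-distrib-/-∣ʳ; m<n⇒m/n≡0; m*n/n≡m)
open import Data.Nat.GCD using (gcd)
open import Data.Nat.LCM using (lcm; lcm-least; gcd*lcm)
open import Data.Nat.Primality using (prime; prime?; prime⇒nonZero)
open import Data.Nat.Properties
  using (+-assoc; +-comm; +-suc; +-identityʳ; *-identityˡ; *-assoc; +-cancelʳ-≡; +-cancelˡ-≡;
         ≤-refl; ≤-trans; m≤m+n; m<m+n; <⇒≱; ≤∧≢⇒<; m<n⇒m<1+n; m*n≢0; module ≤-Reasoning)
import Data.Nat.Tactic.RingSolver as ℕ-Solver
open import Data.Sum using (_⊎_; inj₁; inj₂)
open import Function using (_∘_; _⇔_; mk⇔; Equivalence)
open import Relation.Nullary using (Dec; yes; no; does; contradiction)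
open import Relation.Binary.PropositionalEquality
  using (refl; sym; trans; cong; cong₂; subst; module ≡-Reasoning)

+ᶻ-pos-assoc : ∀ b m n → b +ᶻ + (m + n) ≡ (b +ᶻ + m) +ᶻ + n
+ᶻ-pos-assoc b m n = trans (cong (b +ᶻ_) (pos-+ m n)) (sym (+ᶻ-assoc b (+ m) (+ n)))

module Window {Q : ℤ → Set} (Q? : ∀ x → Dec (Q x)) where

  hit : ℤ → ℕ
  hit x = if does (Q? x) then 1 else 0

  hits : ℤ → ℕ → ℕ
  hits b n = count n (λ j → Q (b +ᶻ + suc j)) (λ j → Q? (b +ᶻ + suc j))

  hit-yes : ∀ {x} → Q x → hit x ≡ 1
  hit-yes {x} qx with Q? x
  ... | yes _   = refl
  ... | no ¬qx = contradiction qx ¬qx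

  hit-no : ∀ {x} → ¬ Q x → hit x ≡ 0
  hit-no {x} ¬qx with Q? x
  ... | yes qx = contradiction qx ¬qx
  ... | no _   = refl

  hit≡1⇒ : ∀ {x} → hit x ≡ 1 → Q x
  hit≡1⇒ {x} eq with Q? x | eq
  ... | yes qx | _ = qx

  hit-cong : ∀ x y → (Q x → Q y) → (Q y → Q x) → hit x ≡ hit y
  hit-cong x y to from with Q? x | Q? y
  ... | yes _  | yes _  = refl
  ... | no _   | no _   = refl
  ... | yes qx | no ¬qy = contradiction (to qx) ¬qy
  ... | no ¬qx | yes qy = contradiction (from qy) ¬qx

  hit+hit≡1 : ∀ {x y} → Q x ⊎ Q y → ¬ (Q x × Q y) → hit x + hit y ≡ 1
  hit+hit≡1 {x} {y} one ¬both with Q? x | Q? y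
  ... | yes qx | yes qy = contradiction (qx , qy) ¬both
  ... | yes _  | no _   = refl
  ... | no _   | yes _  = refl
  ... | no ¬qx | no ¬qy with one
  ...   | inj₁ qx = contradiction qx ¬qx
  ...   | inj₂ qy = contradiction qy ¬qy

  hits-+ : ∀ b m n → hits b (m + n) ≡ hits b m + hits (b +ᶻ + m) n
  hits-+ b m zero = trans (cong (hits b) (+-identityʳ m)) (sym (+-identityʳ _))
  hits-+ b m (suc n) = begin
    hits b (m + suc n)                                   ≡⟨ cong (hits b) (+-suc m n) ⟩
    hits b (m + n) + hit (b +ᶻ + suc (m + n))            ≡⟨ cong₂ _+_ (hits-+ b m n) (cong hit last≡) ⟩
    hits b m + hits (b +ᶻ + m) n + hit ((b +ᶻ + m) +ᶻ + suc n) ≡⟨ +-assoc (hits b m) _ _ ⟩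
    hits b m + hits (b +ᶻ + m) (suc n)                   ∎
    where
    open ≡-Reasoning
    last≡ : b +ᶻ + suc (m + n) ≡ (b +ᶻ + m) +ᶻ + suc n
    last≡ = trans (cong (λ k → b +ᶻ + k) (sym (+-suc m n))) (+ᶻ-pos-assoc b m (suc n))

  hits-cons : ∀ b n → hits b (suc n) ≡ hit (b +ᶻ 1ℤ) + hits (b +ᶻ 1ℤ) n
  hits-cons b n = hits-+ b 1 n

  hits-none : ∀ b n → (∀ j → j < n → ¬ Q (b +ᶻ + suc j)) → hits b n ≡ 0
  hits-none b zero    _    = refl
  hits-none b (suc n) none =
    cong₂ _+_ (hits-none b n (λ j j<n → none j (m<n⇒m<1+n j<n))) (hit-no (none n ≤-refl))

  hits-translate : ∀ s → (∀ x → hit (x +ᶻ s) ≡ hit x) → ∀ b n → hits (b +ᶻ s) n ≡ hits b n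
  hits-translate s invariant b zero    = refl
  hits-translate s invariant b (suc n) =
    cong₂ _+_ (hits-translate s invariant b n)
              (trans (cong hit (right-comm b s (+ suc n))) (invariant (b +ᶻ + suc n)))
    where
    right-comm : ∀ (a c d : ℤ) → (a +ᶻ c) +ᶻ d ≡ (a +ᶻ d) +ᶻ c
    right-comm = solve-∀

  hits-slide : ∀ b n → hits (b +ᶻ 1ℤ) n + hit (b +ᶻ 1ℤ) ≡ hits b n + hit ((b +ᶻ 1ℤ) +ᶻ + n)
  hits-slide b n = begin
    hits (b +ᶻ 1ℤ) n + hit (b +ᶻ 1ℤ)   ≡⟨ +-comm (hits (b +ᶻ 1ℤ) n) _ ⟩
    hit (b +ᶻ 1ℤ) + hits (b +ᶻ 1ℤ) n   ≡⟨ hits-cons b n ⟨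
    hits b (suc n)                     ≡⟨ cong (λ y → hits b n + y) (cong hit (+ᶻ-pos-assoc b 1 n)) ⟩
    hits b n + hit ((b +ᶻ 1ℤ) +ᶻ + n)  ∎
    where open ≡-Reasoning

  hits-slide-≡ : ∀ b n → hit (b +ᶻ 1ℤ) ≡ hit ((b +ᶻ 1ℤ) +ᶻ + n) → hits (b +ᶻ 1ℤ) n ≡ hits b n
  hits-slide-≡ b n same = +-cancelʳ-≡ _ _ _ (trans (hits-slide b n) (cong (λ y → hits b n + y) (sym same)))

  hits-slide-≤ : ∀ b n → ¬ Q ((b +ᶻ 1ℤ) +ᶻ + n) → hits (b +ᶻ 1ℤ) n ≤ hits b n
  hits-slide-≤ b n ¬q = begin
    hits (b +ᶻ 1ℤ) n                  ≤⟨ m≤m+n _ _ ⟩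
    hits (b +ᶻ 1ℤ) n + hit (b +ᶻ 1ℤ)  ≡⟨ hits-slide b n ⟩
    hits b n + hit ((b +ᶻ 1ℤ) +ᶻ + n) ≡⟨ cong (λ y → hits b n + y) (hit-no ¬q) ⟩
    hits b n + 0                      ≡⟨ +-identityʳ _ ⟩
    hits b n                          ∎
    where open ≤-Reasoning

module _ {A : Set} (g : ℤ → A) (s : ℤ) (periodic : ∀ x → g (x +ᶻ s) ≡ g x) where

  private
    periodic⇒invariant⁺ : ∀ x n → g (x +ᶻ + n *ᶻ s) ≡ g x
    periodic⇒invariant⁺ x zero    = cong g (x+0*s≡x x s)
      where
      x+0*s≡x : ∀ (x s : ℤ) → x +ᶻ 0ℤ *ᶻ s ≡ x
      x+0*s≡x = solve-∀
    periodic⇒invariant⁺ x (suc n) =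
      trans (cong g (step x (+ n) s)) (trans (periodic _) (periodic⇒invariant⁺ x n))
      where
      step : ∀ (x a s : ℤ) → x +ᶻ (1ℤ +ᶻ a) *ᶻ s ≡ (x +ᶻ a *ᶻ s) +ᶻ s
      step = solve-∀

  periodic⇒invariant : ∀ x c → g (x +ᶻ c *ᶻ s) ≡ g x
  periodic⇒invariant x (+ n)     = periodic⇒invariant⁺ x n
  periodic⇒invariant x -[1+ n ] =
    trans (sym (periodic⇒invariant⁺ (x +ᶻ -[1+ n ] *ᶻ s) (suc n))) (cong g (cancel x (+ suc n) s))
    where
    cancel : ∀ (x a s : ℤ) → (x +ᶻ (- a) *ᶻ s) +ᶻ a *ᶻ s ≡ x
    cancel = solve-∀

periodic⇒∃minimiser : (g : ℤ → ℕ) (P : ℕ) .{{_ : NonZero P}} → (∀ x → g (x +ᶻ + P) ≡ g x) →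
                      ∃ λ b → ∀ b′ → g b ≤ g b′
periodic⇒∃minimiser g P periodic = + r₀ , λ b′ → begin
  g (+ r₀)                                ≤⟨ lookup (f[argmin]≤f[xs] {f = g ∘ +_} 0 (upTo P))
                                                     (∈-upTo⁺ (n%ℕd<d b′ P)) ⟩
  g (+ (b′ %ℕ P))                         ≡⟨ periodic⇒invariant g (+ P) periodic _ (b′ /ℕ P) ⟨
  g (+ (b′ %ℕ P) +ᶻ (b′ /ℕ P) *ᶻ + P)     ≡⟨ cong g (a≡a%ℕn+[a/ℕn]*n b′ P) ⟨
  g b′                                    ∎
  where
  open ≤-Reasoning
  r₀ : ℕ
  r₀ = argmin (g ∘ +_) 0 (upTo P)

ℕ-parity : ∀ n → ∃ λ h → n ≡ h * 2 ⊎ n ≡ suc (h * 2)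
ℕ-parity zero = 0 , inj₁ refl
ℕ-parity (suc n) with ℕ-parity n
... | h , inj₁ refl = h , inj₂ refl
... | h , inj₂ refl = suc h , inj₁ refl

2∣n⇒¬2∣1+n : ∀ {n} → 2 ∣ n → ¬ 2 ∣ suc n
2∣n⇒¬2∣1+n {n} 2∣n 2∣1+n with ∣⇒≤ (∣m+n∣m⇒∣nᴺ (subst (2 ∣_) (+-comm 1 n) 2∣1+n) 2∣n)
... | s≤s ()

ℤ-parity : ∀ x → (+ 2) ∣ᶻ x ⊎ (+ 2) ∣ᶻ x +ᶻ 1ℤ
ℤ-parity x with x %ℕ 2 | n%ℕd<d x 2 | a≡a%ℕn+[a/ℕn]*n x 2
... | 0           | _              | x≡ = inj₁ (divides (x /ℕ 2) (trans x≡ (0+y≡y _)))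
  where
  0+y≡y : ∀ (y : ℤ) → + 0 +ᶻ y ≡ y
  0+y≡y = solve-∀
... | 1           | _              | x≡ =
  inj₂ (divides (x /ℕ 2 +ᶻ 1ℤ) (trans (cong (_+ᶻ 1ℤ) x≡) (regroup (x /ℕ 2))))
  where
  regroup : ∀ (a : ℤ) → (1ℤ +ᶻ a *ᶻ + 2) +ᶻ 1ℤ ≡ (a +ᶻ 1ℤ) *ᶻ + 2
  regroup = solve-∀
... | suc (suc _) | s≤s (s≤s ()) | _

ℤ-parity-+odd : ∀ x {q} → ¬ 2 ∣ q → (+ 2) ∣ᶻ x ⊎ (+ 2) ∣ᶻ x +ᶻ + q
ℤ-parity-+odd x {q} odd with ℤ-parity x | ℤ-parity (x +ᶻ + q)
... | inj₁ 2∣x   | _            = inj₁ 2∣x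
... | inj₂ _     | inj₁ 2∣x+q   = inj₂ 2∣x+q
... | inj₂ 2∣x+1 | inj₂ 2∣x+q+1 =
  contradiction (∣⇒∣ᵤ (∣m+n∣m⇒∣n (subst ((+ 2) ∣ᶻ_) (right-comm x (+ q)) 2∣x+q+1) 2∣x+1)) odd
  where
  right-comm : ∀ (x y : ℤ) → (x +ᶻ y) +ᶻ 1ℤ ≡ (x +ᶻ 1ℤ) +ᶻ y
  right-comm = solve-∀

coprime-∣⇒*∣ : ∀ {m n x} → Coprime m n → m ∣ x → n ∣ x → m * n ∣ x
coprime-∣⇒*∣ {m} {n} coprime m∣x n∣x = subst (_∣ _) lcm≡m*n (lcm-least m∣x n∣x)
  where
  open ≡-Reasoning
  lcm≡m*n : lcm m n ≡ m * n
  lcm≡m*n = begin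
    lcm m n           ≡⟨ *-identityˡ _ ⟨
    1 * lcm m n       ≡⟨ cong (_* lcm m n) (coprime⇒gcd≡1 coprime) ⟨
    gcd m n * lcm m n ≡⟨ gcd*lcm m n ⟩
    m * n             ∎

coprime-∣ᶻ⇒*∣ᶻ : ∀ {m n x} → Coprime m n → (+ m) ∣ᶻ x → (+ n) ∣ᶻ x → (+ (m * n)) ∣ᶻ x
coprime-∣ᶻ⇒*∣ᶻ coprime m∣x n∣x = ∣ᵤ⇒∣ (coprime-∣⇒*∣ coprime (∣⇒∣ᵤ m∣x) (∣⇒∣ᵤ n∣x))

odd-prime⇒coprime : ∀ {q} → Prime q → ¬ q ≡ 2 → Coprime 2 q
odd-prime⇒coprime {q} q-prime@(prime _) q≢2 =
  coprime-sym (prime⇒coprime q-prime (≤∧≢⇒< (nonTrivial⇒n>1 q) (q≢2 ∘ sym)))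

coprime⇒¬2∣ : ∀ {q} → Coprime 2 q → ¬ 2 ∣ q
coprime⇒¬2∣ coprime 2∣q = contradiction (coprime (∣-refl , 2∣q)) λ ()

n<2*n : ∀ n .{{_ : NonZero n}} → n < 2 * n
n<2*n (suc n) = m<m+n (suc n) z<s

⌈r+t*d/d⌉≡1+t : ∀ {r} t d → 0 < r → r ≤ d → ⌈ r + t * d / d ⌉ ≡ suc t
⌈r+t*d/d⌉≡1+t {suc r} t (suc d) _ (s≤s r≤d) = begin
  (suc r + t * suc d + d) / suc d        ≡⟨ cong (_/ suc d) (rearrange r t d) ⟩
  (r + suc t * suc d) / suc d            ≡⟨ +-distrib-/-∣ʳ r (n∣m*n (suc t)) ⟩
  r / suc d + suc t * suc d / suc d      ≡⟨ cong₂ _+_ (m<n⇒m/n≡0 (s≤s r≤d)) (m*n/n≡m (suc t) (suc d)) ⟩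
  suc t                                  ∎
  where
  open ≡-Reasoning
  rearrange : ∀ r t d → suc r + t * suc d + d ≡ r + suc t * suc d
  rearrange = ℕ-Solver.solve-∀

module Multiples (d : ℕ) = Window ((+ d) ∣?_)

F-gap : ∀ {a} q e → suc q ∣ e → (+ suc q) ∣ᶻ a → F a q e ≡ 0
F-gap {a} q e q∣e q∣a = hits-none a q (λ j j<q e∣ → <⇒≱ (s≤s j<q) (∣⇒≤ (q∣1+j e∣)))
  where
  open Multiples e
  q∣1+j : ∀ {j} → (+ e) ∣ᶻ a +ᶻ + suc j → suc q ∣ suc j
  q∣1+j e∣ = ∣⇒∣ᵤ (∣m+n∣m⇒∣n (∣ᶻ-trans (∣ᵤ⇒∣ q∣e) e∣) q∣a)

F-period : ∀ d .{{_ : NonZero d}} b → F b d d ≡ 1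
F-period d@(suc d′) b = begin
  F b d d                ≡⟨ cong (λ x → F x d d) (b≡0+b*1 b) ⟩
  F (0ℤ +ᶻ b *ᶻ 1ℤ) d d  ≡⟨ periodic⇒invariant (λ x → F x d d) 1ℤ slide 0ℤ b ⟩
  F 0ℤ d d               ≡⟨ cong₂ _+_ (F-gap d′ d ∣-refl (divides 0ℤ refl)) (hit-yes ∣ᶻ-refl) ⟩
  1                      ∎
  where
  open ≡-Reasoning
  open Multiples d
  b≡0+b*1 : ∀ (b : ℤ) → b ≡ 0ℤ +ᶻ b *ᶻ 1ℤ
  b≡0+b*1 = solve-∀
  slide : ∀ x → F (x +ᶻ 1ℤ) d d ≡ F x d d
  slide x = hits-slide-≡ x d (hit-cong (x +ᶻ 1ℤ) ((x +ᶻ 1ℤ) +ᶻ + d)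
    (λ d∣ → ∣m∣n⇒∣m+n d∣ ∣ᶻ-refl) (λ d∣ → ∣m+n∣n⇒∣m d∣ ∣ᶻ-refl))

F-periods : ∀ d .{{_ : NonZero d}} b t → F b (t * d) d ≡ t
F-periods d b zero    = refl
F-periods d b (suc t) = trans (hits-+ b d (t * d)) (cong₂ _+_ (F-period d b) (F-periods d (b +ᶻ + d) t))
  where open Multiples d

F[1+t*d]≡1+t⇔∣ : ∀ d .{{_ : NonZero d}} b t → F b (suc (t * d)) d ≡ suc t ⇔ (+ d) ∣ᶻ b +ᶻ 1ℤ
F[1+t*d]≡1+t⇔∣ d b t = mk⇔
  (λ F≡1+t → hit≡1⇒ (+-cancelˡ-≡ t _ _ (trans (sym F≡t+hit) (trans F≡1+t (+-comm 1 t)))))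
  (λ d∣b+1 → trans F≡t+hit (trans (cong (λ n → t + n) (hit-yes d∣b+1)) (+-comm t 1)))
  where
  open Multiples d
  d∣t*d : (+ d) ∣ᶻ + (t * d)
  d∣t*d = divides (+ t) (pos-* t d)
  F≡t+hit : F b (suc (t * d)) d ≡ t + hit (b +ᶻ 1ℤ)
  F≡t+hit = cong₂ _+_ (F-periods d b t)
    (trans (cong hit (+ᶻ-pos-assoc b 1 (t * d)))
           (hit-cong _ (b +ᶻ 1ℤ) (λ d∣ → ∣m+n∣n⇒∣m d∣ d∣t*d) (λ d∣ → ∣m∣n⇒∣m+n d∣ d∣t*d)))

F-double-over-q+1 : ∀ {q} .{{_ : NonZero q}} → Coprime 2 q → ∀ b → (+ q) ∣ᶻ b +ᶻ 1ℤ →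
                    F b (suc q) (2 * q) ≡ 1
-- The multiples of q in the window are x = b + 1 and x + q, and exactly one of them is even.
F-double-over-q+1 {q@(suc q′)} coprime b q∣x = begin
  F b (suc q) (2 * q)                                   ≡⟨ hits-cons b q ⟩
  hit x + (F x q′ (2 * q) + hit (x +ᶻ + q))             ≡⟨ cong (λ n → hit x + (n + hit (x +ᶻ + q)))
                                                                (F-gap q′ (2 * q) (n∣m*n 2) q∣x) ⟩
  hit x + hit (x +ᶻ + q)                                ≡⟨ hit+hit≡1 one-even ¬both ⟩
  1                                                     ∎
  where
  open ≡-Reasoning
  open Multiples (2 * q)
  x = b +ᶻ 1ℤ
  one-even : (+ (2 * q)) ∣ᶻ x ⊎ (+ (2 * q)) ∣ᶻ x +ᶻ + q
  one-even with ℤ-parity-+odd x (coprime⇒¬2∣ coprime)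
  ... | inj₁ 2∣x   = inj₁ (coprime-∣ᶻ⇒*∣ᶻ coprime 2∣x q∣x)
  ... | inj₂ 2∣x+q = inj₂ (coprime-∣ᶻ⇒*∣ᶻ coprime 2∣x+q (∣m∣n⇒∣m+n q∣x ∣ᶻ-refl))
  ¬both : ¬ ((+ (2 * q)) ∣ᶻ x × (+ (2 * q)) ∣ᶻ x +ᶻ + q)
  ¬both (2q∣x , 2q∣x+q) = <⇒≱ (n<2*n q) (∣⇒≤ (∣⇒∣ᵤ (∣m+n∣m⇒∣n 2q∣x+q 2q∣x)))

F-double-even : ∀ {q} .{{_ : NonZero q}} → Coprime 2 q → ∀ b s →
                (+ q) ∣ᶻ b +ᶻ 1ℤ → (+ 2) ∣ᶻ b +ᶻ 1ℤ →
                F b (suc (s * 2 * q)) (2 * q) ≡ ⌈ suc (s * 2 * q) / (2 * q) ⌉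
F-double-even {q} coprime b s q∣b+1 2∣b+1 rewrite *-assoc s 2 q =
  trans (Equivalence.from (F[1+t*d]≡1+t⇔∣ (2 * q) b s) (coprime-∣ᶻ⇒*∣ᶻ coprime 2∣b+1 q∣b+1))
        (sym (⌈r+t*d/d⌉≡1+t s (2 * q) z<s (>-nonZero⁻¹ (2 * q))))
  where instance _ = m*n≢0 2 q

F-double-odd : ∀ {q} .{{_ : NonZero q}} → Coprime 2 q → ∀ b s → (+ q) ∣ᶻ b +ᶻ 1ℤ →
               F b (suc (suc (s * 2) * q)) (2 * q) ≡ ⌈ suc (suc (s * 2) * q) / (2 * q) ⌉
F-double-odd {q} coprime b s q∣b+1 =
  subst (λ n → F b n (2 * q) ≡ ⌈ n / (2 * q) ⌉) (sym (rearrange s q)) (begin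
  F b (suc q + s * (2 * q)) (2 * q)                             ≡⟨ hits-+ b (suc q) _ ⟩
  F b (suc q) (2 * q) + F (b +ᶻ + suc q) (s * (2 * q)) (2 * q)  ≡⟨ cong₂ _+_ (F-double-over-q+1 coprime b q∣b+1)
                                                                              (F-periods (2 * q) (b +ᶻ + suc q) s) ⟩
  suc s                                                         ≡⟨ ⌈r+t*d/d⌉≡1+t s (2 * q) z<s (n<2*n q) ⟨
  ⌈ suc q + s * (2 * q) / (2 * q) ⌉                             ∎)
  where
  open ≡-Reasoning
  open Multiples (2 * q)
  instance _ = m*n≢0 2 q
  rearrange : ∀ s q → suc (suc (s * 2) * q) ≡ suc q + s * (2 * q)
  rearrange = ℕ-Solver.solve-∀

F-double≡⌈⌉ : ∀ {q} .{{_ : NonZero q}} → Coprime 2 q → ∀ b m →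
              (¬ 2 ∣ suc m → (+ 2) ∣ᶻ b +ᶻ 1ℤ) → q ∣ m →
              F b (suc m) q ≡ ⌈ suc m / q ⌉ → F b (suc m) (2 * q) ≡ ⌈ suc m / (2 * q) ⌉
-- F b (1 + t q) q = t + [q ∣ b + 1], so the hypothesis on F b m q forces q ∣ b + 1.
F-double≡⌈⌉ {q} coprime b m even-start (divides t refl) F≡⌈⌉
  with q∣b+1 ← Equivalence.to (F[1+t*d]≡1+t⇔∣ q b t)
                               (trans F≡⌈⌉ (⌈r+t*d/d⌉≡1+t t q z<s (>-nonZero⁻¹ q)))
  with ℕ-parity t
... | s , inj₁ refl =
  F-double-even coprime b s q∣b+1 (even-start (2∣n⇒¬2∣1+n (∣-trans (n∣m*n s) (m∣m*n q))))
... | s , inj₂ refl = F-double-odd coprime b s q∣b+1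

gcd[i+j,j]≡gcd[i,j] : ∀ i j → gcdℤ (i +ᶻ j) j ≡ gcdℤ i j
gcd[i+j,j]≡gcd[i,j] i j =
  cong +_ (∣-antisym (gcd-greatest {i} {j} {g₁} g₁∣i g₁∣j)
                     (gcd-greatest {i +ᶻ j} {j} {g₂} g₂∣i+j g₂∣j))
  where
  g₁ = gcdℤ (i +ᶻ j) j
  g₂ = gcdℤ i j
  g₁∣j : g₁ ℤᵘ.∣ j
  g₁∣j = gcd[i,j]∣j (i +ᶻ j) j
  g₁∣i : g₁ ℤᵘ.∣ i
  g₁∣i = ∣⇒∣ᵤ {g₁} {i}
    (∣m+n∣n⇒∣m (∣ᵤ⇒∣ {g₁} {i +ᶻ j} (gcd[i,j]∣i (i +ᶻ j) j)) (∣ᵤ⇒∣ {g₁} {j} g₁∣j))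
  g₂∣j : g₂ ℤᵘ.∣ j
  g₂∣j = gcd[i,j]∣j i j
  g₂∣i+j : g₂ ℤᵘ.∣ i +ᶻ j
  g₂∣i+j = ∣⇒∣ᵤ {g₂} {i +ᶻ j}
    (∣m∣n⇒∣m+n (∣ᵤ⇒∣ {g₂} {i} (gcd[i,j]∣i i j)) (∣ᵤ⇒∣ {g₂} {j} g₂∣j))

nextPrimeFrom-nonZero : ∀ n fuel → NonZero (nextPrimeFrom n fuel)
nextPrimeFrom-nonZero n zero = _
nextPrimeFrom-nonZero n (suc fuel) with prime? (suc n)
... | yes _ = _
... | no _  = nextPrimeFrom-nonZero (suc n) fuel

p-nonZero : ∀ i → NonZero (p i)
p-nonZero zero    = _
p-nonZero (suc i) = nextPrimeFrom-nonZero (p i) (p i !)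

primorial-nonZero : ∀ k → NonZero (primorial k)
primorial-nonZero zero    = _
primorial-nonZero (suc k) = m*n≢0 (primorial k) (p (suc k)) {{primorial-nonZero k}} {{p-nonZero (suc k)}}

2∣primorial : ∀ {k} → 1 ≤ k → 2 ∣ primorial k
2∣primorial {1}           _ = divides 1 refl
2∣primorial {suc (suc k)} _ = ∣-trans (2∣primorial {suc k} (s≤s z≤n)) (m∣m*n (p (suc (suc k))))

module Totatives (k : ℕ) = Window (λ x → gcdℤ x (+ primorial k) ≟ + 1)

φ-periodic : ∀ m k x → φ (x +ᶻ + primorial k) m k ≡ φ x m k
φ-periodic m k x = hits-translate (+ primorial k) invariant x m
  where
  open Totatives k
  invariant : ∀ y → hit (y +ᶻ + primorial k) ≡ hit y
  invariant y = hit-cong (y +ᶻ + primorial k) y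
    (trans (sym (gcd[i+j,j]≡gcd[i,j] y (+ primorial k)))) (trans (gcd[i+j,j]≡gcd[i,j] y (+ primorial k)))

even⇒¬coprime-primorial : ∀ {k x} → 1 ≤ k → (+ 2) ∣ᶻ x → ¬ gcdℤ x (+ primorial k) ≡ + 1
even⇒¬coprime-primorial {k} {x} 1≤k 2∣x gcd≡1
  with ∣⇒≤ (subst (ℤᵘ._∣_ (+ 2)) gcd≡1
              (gcd-greatest {x} {+ primorial k} {+ 2} (∣⇒∣ᵤ 2∣x) (2∣primorial 1≤k)))
... | s≤s ()

φ-shift-to-even-start : ∀ {k} b h → 1 ≤ k → (+ 2) ∣ᶻ b →
                        φ (b +ᶻ 1ℤ) (suc (h * 2)) k ≤ φ b (suc (h * 2)) k
φ-shift-to-even-start {k} b h 1≤k 2∣b =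
  hits-slide-≤ b (suc (h * 2)) (even⇒¬coprime-primorial 1≤k 2∣last)
  where
  open Totatives k
  2∣last : (+ 2) ∣ᶻ (b +ᶻ 1ℤ) +ᶻ + suc (h * 2)
  2∣last = subst ((+ 2) ∣ᶻ_) (+ᶻ-pos-assoc b 1 (suc (h * 2)))
                 (∣m∣n⇒∣m+n 2∣b (divides (+ suc h) (pos-* (suc h) 2)))

φ-∃minimiser : ∀ k m → ∃ λ b → AttainsMin b m k
φ-∃minimiser k m =
  periodic⇒∃minimiser (λ b → φ b m k) (primorial k) {{primorial-nonZero k}} (φ-periodic m k)

minimiser⇒even-start-minimiser : ∀ {k m} b₀ → 1 ≤ k → AttainsMin b₀ m k →
                                 ∃ λ b → AttainsMin b m k × (¬ 2 ∣ m → (+ 2) ∣ᶻ b +ᶻ 1ℤ)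
minimiser⇒even-start-minimiser {m = m} b₀ 1≤k b₀-min with ℤ-parity b₀ | ℕ-parity m
... | inj₂ 2∣b₀+1 | _            = b₀ , b₀-min , λ _ → 2∣b₀+1
... | inj₁ _      | h , inj₁ refl = b₀ , b₀-min , λ m-odd → contradiction (divides h refl) m-odd
... | inj₁ 2∣b₀   | h , inj₂ refl =
  b₀ +ᶻ 1ℤ , (λ b′ → ≤-trans (φ-shift-to-even-start b₀ h 1≤k 2∣b₀) (b₀-min b′)) ,
  λ _ → subst ((+ 2) ∣ᶻ_) (+ᶻ-pos-assoc b₀ 1 1) (∣m∣n⇒∣m+n 2∣b₀ ∣ᶻ-refl)

theorem4p3 : (k m : ℕ) → 1 ≤ k → 1 ≤ m →
    ∃ λ (b : ℤ) → AttainsMin b m k ×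
      ((q : ℕ) → Prime q → ¬ (q ≡ 2) → q ∣ (m ∸ 1) →
        F b m q ≡ ⌈ m / q ⌉ →
        F b m (2 * q) ≡ ⌈ m / (2 * q) ⌉)
theorem4p3 k (suc m) 1≤k _ =
  let b₀ , b₀-min            = φ-∃minimiser k (suc m)
      b , b-min , even-start = minimiser⇒even-start-minimiser b₀ 1≤k b₀-min
  in b , b-min , λ q q-prime q≢2 →
       F-double≡⌈⌉ {{prime⇒nonZero q-prime}} (odd-prime⇒coprime q-prime q≢2) b m even-start
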